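{- Let $n\ge 1$ and let $\mathcal F,\mathcal G\subset 2^{[n]}$ be cross-intersecting. Then $|\mathcal F|+|\mathcal G|\le\max\{|\mathcal F^{\downarrow}|,|\mathcal G^{\downarrow}|\}$.
   Context: Families $\mathcal F,\mathcal G\subset 2^{[n]}$ are cross-intersecting if $A\cap B\ne\emptyset$ for all $A\in\mathcal F$, $B\in\mathcal G$. For a family $\mathcal F$, $\mathcal F^{\downarrow}=\{G: \exists F\in\mathcal F,\ G\subset F\}$ is the down-set generated by $\mathcal F$. -}

module Defs where

open import Data.Nat using (ℕ; zero; suc)
open import Data.Bool using (Bool; true; false)
open import Data.List using (List; []; _∷_; map; _++_; filter; length)
open import Data.Vec using (_∷_; [])
open import Data.Fin.Subset using (Subset; _⊆_; _∩_; Nonempty)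
open import Data.Fin.Subset.Properties using (_⊆?_)
open import Data.Product using (∃; _×_; _,_)
open import Level using (0ℓ)
open import Relation.Unary using (Pred; Decidable)
open import Relation.Nullary using (Dec; yes; no)
open import Relation.Nullary.Decidable using (_×-dec_)
open import Data.List.Relation.Unary.Any using (Any)
import Data.List.Relation.Unary.Any as Any
open import Data.List.Membership.Propositional using (_∈_)
open import Data.List.Membership.Propositional.Properties using (∈-map⁺; ∈-++⁺ˡ; ∈-++⁺ʳ)
open import Relation.Binary.PropositionalEquality using (_≡_; refl)

allSubsets : (n : ℕ) → List (Subset n)
allSubsets zero = [] ∷ []
allSubsets (suc n) = map (true ∷_) (allSubsets n) ++ map (false ∷_) (allSubsets n)

record Family (n : ℕ) : Set₁ where
  field
    mem  : Pred (Subset n) 0ℓ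
    mem? : Decidable mem
open Family public

card : ∀ {n} → Family n → ℕ
card {n} 𝓕 = length (filter (mem? 𝓕) (allSubsets n))

CrossIntersecting : ∀ {n} → Family n → Family n → Set
CrossIntersecting 𝓕 𝓖 = ∀ A B → mem 𝓕 A → mem 𝓖 B → Nonempty (A ∩ B)

InDown : ∀ {n} → Family n → Pred (Subset n) 0ℓ
InDown 𝓕 G = ∃ λ F → mem 𝓕 F × G ⊆ F

allSubsets-complete : ∀ {n} (F : Subset n) → F ∈ allSubsets n
allSubsets-complete [] = Any.here refl
allSubsets-complete {suc n} (true ∷ F) =
  ∈-++⁺ˡ (∈-map⁺ (true ∷_) (allSubsets-complete F))
allSubsets-complete {suc n} (false ∷ F) =
  ∈-++⁺ʳ (map (true ∷_) (allSubsets n)) (∈-map⁺ (false ∷_) (allSubsets-complete F))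

InDown? : ∀ {n} (𝓕 : Family n) → Decidable (InDown 𝓕)
InDown? {n} 𝓕 G with Any.any? (λ F → mem? 𝓕 F ×-dec (G ⊆? F)) (allSubsets n)
... | yes p = yes (Any.satisfied p)
... | no ¬p = no λ { (F , F∈ , G⊆F) →
  ¬p (Any.map (λ { refl → F∈ , (λ {x} → G⊆F {x}) }) (allSubsets-complete F)) }

_↓ : ∀ {n} → Family n → Family n
𝓕 ↓ = record { mem = InDown 𝓕 ; mem? = InDown? 𝓕 }

{-# OPTIONS --safe #-}
-- By the Harris–Kleitman inequality a down-set and an up-set of the cube are
-- negatively correlated, so |𝓕| ≤ |𝓕↓ ∩ 𝓕↑| ≤ |𝓕↓| |𝓕↑| / 2ⁿ, and likewise for 𝓖.
-- Cross-intersection forbids X ∈ 𝓕↑ together with [n] ∖ X ∈ 𝓖↑, so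
-- |𝓕↑| + |𝓖↑| ≤ 2ⁿ. Hence
-- |𝓕| + |𝓖| ≤ max(|𝓕↓|, |𝓖↓|) (|𝓕↑| + |𝓖↑|) / 2ⁿ ≤ max(|𝓕↓|, |𝓖↓|).
-- Harris–Kleitman itself goes by induction on n, splitting the cube along the
-- first coordinate; the two halves are combined by Chebyshev's sum inequality.
module Submission where

open import Defs
open import Data.Nat using (ℕ; zero; suc; _+_; _*_; _^_; _≤_; _⊔_; z≤n; NonZero)
open import Data.Nat.Properties
open import Data.Nat.Tactic.RingSolver using (solve-∀)
open import Data.Bool using (Bool; true; false)
open import Data.List using (List; []; _∷_; map; _++_; filter; length)
open import Data.List.Properties using (filter-++; length-++)
import Data.List.Relation.Unary.Any as Any
open import Data.Vec using (_∷_; [])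
open import Data.Fin.Subset using (Subset; _⊆_; ∁)
open import Data.Fin.Subset.Properties using (_⊆?_; ⊆-refl; ⊆-trans; s⊆s; out⊆; x∈p∩q⁻; x∈p⇒x∉∁p)
open import Data.Product using (∃; _×_; _,_)
open import Function using (_∘_)
open import Relation.Unary using (Pred; Decidable)
open import Relation.Nullary using (yes; no; ¬_)
open import Relation.Nullary.Decidable using (_×-dec_)
open import Data.Empty using (⊥-elim)
open import Relation.Binary.PropositionalEquality using (_≡_; refl; cong; cong₂; subst; module ≡-Reasoning)

private
  variable
    n : ℕ

length-filter-map : ∀ {a b p} {A : Set a} {B : Set b} {P : Pred B p}
  (P? : Decidable P) (f : A → B) (xs : List A) →
  length (filter P? (map f xs)) ≡ length (filter (P? ∘ f) xs)
length-filter-map P? f [] = refl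
length-filter-map P? f (x ∷ xs) with P? (f x)
... | yes _ = cong suc (length-filter-map P? f xs)
... | no _ = length-filter-map P? f xs

slice : Bool → Family (suc n) → Family n
slice b 𝓕 = record { mem = λ x → mem 𝓕 (b ∷ x) ; mem? = λ x → mem? 𝓕 (b ∷ x) }

infixl 7 _∩ᶠ_

_∩ᶠ_ : Family n → Family n → Family n
𝓐 ∩ᶠ 𝓑 = record { mem = λ x → mem 𝓐 x × mem 𝓑 x ; mem? = λ x → mem? 𝓐 x ×-dec mem? 𝓑 x }

InUp : Family n → Pred (Subset n) _
InUp 𝓕 G = ∃ λ F → mem 𝓕 F × F ⊆ G

InUp? : (𝓕 : Family n) → Decidable (InUp 𝓕)
InUp? {n} 𝓕 G with Any.any? (λ F → mem? 𝓕 F ×-dec (F ⊆? G)) (allSubsets n)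
... | yes p = yes (Any.satisfied p)
... | no ¬p = no λ { (F , F∈ , F⊆G) →
  ¬p (Any.map (λ { refl → F∈ , (λ {x} → F⊆G {x}) }) (allSubsets-complete F)) }

_↑ : Family n → Family n
𝓕 ↑ = record { mem = InUp 𝓕 ; mem? = InUp? 𝓕 }

DownClosed : Family n → Set
DownClosed 𝓓 = ∀ {x y} → x ⊆ y → mem 𝓓 y → mem 𝓓 x

UpClosed : Family n → Set
UpClosed 𝓤 = ∀ {x y} → x ⊆ y → mem 𝓤 x → mem 𝓤 y

↓-downClosed : (𝓕 : Family n) → DownClosed (𝓕 ↓)
↓-downClosed 𝓕 x⊆y (F , F∈ , y⊆F) = F , F∈ , ⊆-trans x⊆y y⊆F

↑-upClosed : (𝓕 : Family n) → UpClosed (𝓕 ↑)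
↑-upClosed 𝓕 x⊆y (F , F∈ , F⊆x) = F , F∈ , ⊆-trans F⊆x x⊆y

card-slices : (𝓕 : Family (suc n)) → card 𝓕 ≡ card (slice true 𝓕) + card (slice false 𝓕)
card-slices {n} 𝓕 =
  let ins = map (true ∷_) (allSubsets n)
      outs = map (false ∷_) (allSubsets n)
  in begin
    length (filter (mem? 𝓕) (ins ++ outs))
      ≡⟨ cong length (filter-++ (mem? 𝓕) ins outs) ⟩
    length (filter (mem? 𝓕) ins ++ filter (mem? 𝓕) outs)
      ≡⟨ length-++ (filter (mem? 𝓕) ins) ⟩
    length (filter (mem? 𝓕) ins) + length (filter (mem? 𝓕) outs)
      ≡⟨ cong₂ _+_ (length-filter-map (mem? 𝓕) (true ∷_) (allSubsets n))
                   (length-filter-map (mem? 𝓕) (false ∷_) (allSubsets n)) ⟩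
    card (slice true 𝓕) + card (slice false 𝓕) ∎
  where
  open ≡-Reasoning

card-mono : {𝓐 𝓑 : Family n} → (∀ {x} → mem 𝓐 x → mem 𝓑 x) → card 𝓐 ≤ card 𝓑
card-mono {zero} {𝓐} {𝓑} 𝓐⊆𝓑 with mem? 𝓐 [] | mem? 𝓑 []
... | yes _ | yes _ = ≤-refl
... | yes x∈𝓐 | no x∉𝓑 = ⊥-elim (x∉𝓑 (𝓐⊆𝓑 x∈𝓐))
... | no _ | _ = z≤n
card-mono {suc n} {𝓐} {𝓑} 𝓐⊆𝓑 = begin
  card 𝓐                                        ≡⟨ card-slices 𝓐 ⟩
  card (slice true 𝓐) + card (slice false 𝓐)  ≤⟨ +-mono-≤ (card-mono {𝓐 = slice true 𝓐} {slice true 𝓑} 𝓐⊆𝓑)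
                                                          (card-mono {𝓐 = slice false 𝓐} {slice false 𝓑} 𝓐⊆𝓑) ⟩
  card (slice true 𝓑) + card (slice false 𝓑)  ≡⟨ card-slices 𝓑 ⟨
  card 𝓑                                        ∎
  where open ≤-Reasoning

complement-disjoint⇒card+card≤2^n : (𝓐 𝓑 : Family n) → (∀ x → mem 𝓐 x → ¬ mem 𝓑 (∁ x)) →
  card 𝓐 + card 𝓑 ≤ 2 ^ n
complement-disjoint⇒card+card≤2^n {zero} 𝓐 𝓑 disjoint with mem? 𝓐 [] | mem? 𝓑 []
... | yes []∈𝓐 | yes []∈𝓑 = ⊥-elim (disjoint [] []∈𝓐 []∈𝓑)
... | yes _ | no _ = ≤-refl
... | no _ | yes _ = ≤-refl
... | no _ | no _ = z≤n
complement-disjoint⇒card+card≤2^n {suc n} 𝓐 𝓑 disjoint = begin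
  card 𝓐 + card 𝓑                ≡⟨ cong₂ _+_ (card-slices 𝓐) (card-slices 𝓑) ⟩
  -- ∁ (b ∷ x) = not b ∷ ∁ x: the true slice of 𝓐 faces the false slice of 𝓑.
  (a₁ + a₀) + (b₁ + b₀)          ≡⟨ regroup a₁ a₀ b₁ b₀ ⟩
  (a₁ + b₀) + (a₀ + b₁)          ≤⟨ +-mono-≤ (complement-disjoint⇒card+card≤2^n _ _ (disjoint ∘ (true ∷_)))
                                              (complement-disjoint⇒card+card≤2^n _ _ (disjoint ∘ (false ∷_))) ⟩
  2 ^ n + 2 ^ n                  ≡⟨ cong (2 ^ n +_) (+-identityʳ (2 ^ n)) ⟨
  2 ^ suc n                      ∎
  where
  open ≤-Reasoning
  a₁ = card (slice true 𝓐)
  a₀ = card (slice false 𝓐)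
  b₁ = card (slice true 𝓑)
  b₀ = card (slice false 𝓑)
  regroup : ∀ a₁ a₀ b₁ b₀ → (a₁ + a₀) + (b₁ + b₀) ≡ (a₁ + b₀) + (a₀ + b₁)
  regroup = solve-∀

-- The two sides differ by (d₀ ∸ d₁) * (u₁ ∸ u₀).
chebyshev₂ : ∀ {d₁ d₀ u₁ u₀} → d₁ ≤ d₀ → u₀ ≤ u₁ →
  2 * (d₁ * u₁ + d₀ * u₀) ≤ (d₁ + d₀) * (u₁ + u₀)
chebyshev₂ {d₁} {u₀ = u₀} d₁≤d₀ u₀≤u₁
  with p , refl ← m≤n⇒∃[o]m+o≡n d₁≤d₀ | q , refl ← m≤n⇒∃[o]m+o≡n u₀≤u₁ =
  subst (2 * (d₁ * (u₀ + q) + (d₁ + p) * u₀) ≤_) (expand d₁ p u₀ q) (m≤m+n _ (p * q))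
  where
  expand : ∀ d₁ p u₀ q →
    2 * (d₁ * (u₀ + q) + (d₁ + p) * u₀) + p * q ≡ (d₁ + (d₁ + p)) * ((u₀ + q) + u₀)
  expand = solve-∀

slice-downClosed : ∀ b (𝓓 : Family (suc n)) → DownClosed 𝓓 → DownClosed (slice b 𝓓)
slice-downClosed b 𝓓 down x⊆y = down (s⊆s x⊆y)

slice-upClosed : ∀ b (𝓤 : Family (suc n)) → UpClosed 𝓤 → UpClosed (slice b 𝓤)
slice-upClosed b 𝓤 up x⊆y = up (s⊆s x⊆y)

card-slice-true≤false : (𝓓 : Family (suc n)) → DownClosed 𝓓 →
  card (slice true 𝓓) ≤ card (slice false 𝓓)
card-slice-true≤false 𝓓 down =
  card-mono {𝓐 = slice true 𝓓} {slice false 𝓓} (down (out⊆ ⊆-refl))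

card-slice-false≤true : (𝓤 : Family (suc n)) → UpClosed 𝓤 →
  card (slice false 𝓤) ≤ card (slice true 𝓤)
card-slice-false≤true 𝓤 up =
  card-mono {𝓐 = slice false 𝓤} {slice true 𝓤} (up (out⊆ ⊆-refl))

harris-kleitman : (𝓓 𝓤 : Family n) → DownClosed 𝓓 → UpClosed 𝓤 →
  2 ^ n * card (𝓓 ∩ᶠ 𝓤) ≤ card 𝓓 * card 𝓤
harris-kleitman {zero} 𝓓 𝓤 _ _ with mem? 𝓓 [] | mem? 𝓤 []
... | yes _ | yes _ = ≤-refl
... | yes _ | no _ = z≤n
... | no _ | _ = z≤n
harris-kleitman {suc n} 𝓓 𝓤 down up = begin
  2 ^ suc n * card (𝓓 ∩ᶠ 𝓤)           ≡⟨ cong (2 ^ suc n *_) (card-slices (𝓓 ∩ᶠ 𝓤)) ⟩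
  2 * 2 ^ n * (c₁ + c₀)               ≡⟨ distrib (2 ^ n) c₁ c₀ ⟩
  2 * (2 ^ n * c₁ + 2 ^ n * c₀)       ≤⟨ *-monoʳ-≤ 2 (+-mono-≤ (slice-bound true) (slice-bound false)) ⟩
  2 * (d₁ * u₁ + d₀ * u₀)             ≤⟨ chebyshev₂ (card-slice-true≤false 𝓓 down) (card-slice-false≤true 𝓤 up) ⟩
  (d₁ + d₀) * (u₁ + u₀)               ≡⟨ cong₂ _*_ (card-slices 𝓓) (card-slices 𝓤) ⟨
  card 𝓓 * card 𝓤                     ∎
  where
  open ≤-Reasoning
  c₁ = card (slice true (𝓓 ∩ᶠ 𝓤))
  c₀ = card (slice false (𝓓 ∩ᶠ 𝓤))
  d₁ = card (slice true 𝓓)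
  d₀ = card (slice false 𝓓)
  u₁ = card (slice true 𝓤)
  u₀ = card (slice false 𝓤)
  distrib : ∀ t a b → 2 * t * (a + b) ≡ 2 * (t * a + t * b)
  distrib = solve-∀
  slice-bound : ∀ b → 2 ^ n * card (slice b (𝓓 ∩ᶠ 𝓤)) ≤ card (slice b 𝓓) * card (slice b 𝓤)
  slice-bound b = harris-kleitman (slice b 𝓓) (slice b 𝓤)
    (slice-downClosed b 𝓓 down) (slice-upClosed b 𝓤 up)

2^n*card≤card↓*card↑ : (𝓕 : Family n) → 2 ^ n * card 𝓕 ≤ card (𝓕 ↓) * card (𝓕 ↑)
2^n*card≤card↓*card↑ {n} 𝓕 = begin
  2 ^ n * card 𝓕                 ≤⟨ *-monoʳ-≤ (2 ^ n) (card-mono {𝓐 = 𝓕} {𝓕 ↓ ∩ᶠ 𝓕 ↑} 𝓕⊆↓∩↑) ⟩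
  2 ^ n * card (𝓕 ↓ ∩ᶠ 𝓕 ↑)     ≤⟨ harris-kleitman (𝓕 ↓) (𝓕 ↑) (↓-downClosed 𝓕) (↑-upClosed 𝓕) ⟩
  card (𝓕 ↓) * card (𝓕 ↑)       ∎
  where
  open ≤-Reasoning
  𝓕⊆↓∩↑ : ∀ {x} → mem 𝓕 x → mem (𝓕 ↓ ∩ᶠ 𝓕 ↑) x
  𝓕⊆↓∩↑ x∈𝓕 = (_ , x∈𝓕 , ⊆-refl) , (_ , x∈𝓕 , ⊆-refl)

crossIntersecting⇒card↑+card↑≤2^n : (𝓕 𝓖 : Family n) → CrossIntersecting 𝓕 𝓖 →
  card (𝓕 ↑) + card (𝓖 ↑) ≤ 2 ^ n
crossIntersecting⇒card↑+card↑≤2^n 𝓕 𝓖 cross =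
  complement-disjoint⇒card+card≤2^n (𝓕 ↑) (𝓖 ↑) antipodal
  where
  antipodal : ∀ x → InUp 𝓕 x → ¬ InUp 𝓖 (∁ x)
  antipodal x (A , A∈𝓕 , A⊆x) (B , B∈𝓖 , B⊆∁x) with i , i∈A∩B ← cross A B A∈𝓕 B∈𝓖 =
    let i∈A , i∈B = x∈p∩q⁻ A B i∈A∩B in x∈p⇒x∉∁p (A⊆x i∈A) (B⊆∁x i∈B)

+-≤-⊔-of-weighted : ∀ k {a b d e u v} .{{_ : NonZero k}} →
  k * a ≤ d * u → k * b ≤ e * v → u + v ≤ k → a + b ≤ d ⊔ e
+-≤-⊔-of-weighted k {a} {b} {d} {e} {u} {v} ka≤du kb≤ev u+v≤k = *-cancelˡ-≤ k (begin
  k * (a + b)         ≡⟨ *-distribˡ-+ k a b ⟩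
  k * a + k * b       ≤⟨ +-mono-≤ ka≤du kb≤ev ⟩
  d * u + e * v       ≤⟨ +-mono-≤ (*-monoˡ-≤ u (m≤m⊔n d e)) (*-monoˡ-≤ v (m≤n⊔m d e)) ⟩
  (d ⊔ e) * u + (d ⊔ e) * v  ≡⟨ *-distribˡ-+ (d ⊔ e) u v ⟨
  (d ⊔ e) * (u + v)   ≤⟨ *-monoʳ-≤ (d ⊔ e) u+v≤k ⟩
  (d ⊔ e) * k         ≡⟨ *-comm (d ⊔ e) k ⟩
  k * (d ⊔ e)         ∎)
  where open ≤-Reasoning

theorem6 : (n : ℕ) → 1 ≤ n → (𝓕 𝓖 : Family n) → CrossIntersecting 𝓕 𝓖 →
    card 𝓕 + card 𝓖 ≤ card (𝓕 ↓) ⊔ card (𝓖 ↓)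
theorem6 n _ 𝓕 𝓖 cross =
  +-≤-⊔-of-weighted (2 ^ n) {d = card (𝓕 ↓)} {card (𝓖 ↓)} {card (𝓕 ↑)} {card (𝓖 ↑)} {{m^n≢0 2 n}}
    (2^n*card≤card↓*card↑ 𝓕)
    (2^n*card≤card↓*card↑ 𝓖)
    (crossIntersecting⇒card↑+card↑≤2^n 𝓕 𝓖 cross)
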